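{- Let $G$ and $H$ be graphs such that the direct product $G\times H$ is a balanced distance magic graph, and let $\ell$ be a balanced distance magic labeling of $G\times H$ in which $(g,h)$ and $(g',h')$ are twin vertices, where $g\neq g'$ and $h\neq h'$. Then the labeling obtained from $\ell$ by exchanging the labels of $(g',h')$ and $(g',h)$ is a balanced distance magic labeling of $G\times H$ in which $(g,h)$ and $(g',h)$ are twin vertices.
   Context: All graphs are finite and simple; $N(x)$ is the open neighborhood of $x$. A distance magic labeling of a graph $X$ of order $n$ is a bijection $\ell\colon V(X)\to\{1,\ldots,n\}$ for which there is a positive integer $k$ with $\sum_{y\in N(x)}\ell(y)=k$ for every vertex $x$. A distance magic graph $X$ with an even number of vertices is balanced if there exists a bijection $\ell\colon V(X)\to\{1,\ldots,|V(X)|\}$ such that for every $w\in V(X)$: whenever $u\in N(w)$ has $\ell(u)=i$, there exists $v\in N(w)$ with $\ell(v)=|V(X)|+1-i$; such $\ell$ is a balanced distance magic labeling. For such a labeling, two vertices $u,v$ with $\ell(u)+\ell(v)=|V(X)|+1$ are called twin vertices (twins). The direct product $G\times H$ has vertex set $V(G)\times V(H)$, with $(g,h)$ adjacent to $(g',h')$ iff $gg'\in E(G)$ and $hh'\in E(H)$. -}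

module Defs where

open import Data.Nat using (ℕ; zero; suc; _+_; _*_; _≤_; _<_)
open import Data.Nat.Properties using ()
open import Data.Bool using (Bool; true; false; _∧_; if_then_else_)
open import Data.Fin using (Fin; zero; suc)
open import Data.Fin.Properties using () renaming (_≟_ to _≟ᶠ_)
open import Data.Product using (_×_; _,_; Σ; ∃; ∃-syntax)
open import Data.Product.Properties using (≡-dec)
open import Relation.Binary.PropositionalEquality using (_≡_)
open import Relation.Nullary using (yes; no)
open import Function.Definitions using (Injective)

record Graph : Set where
  field
    order  : ℕ
    adj    : Fin order → Fin order → Bool
    symm   : ∀ x y → adj x y ≡ adj y x
    irrefl : ∀ x → adj x x ≡ false
open Graph public

PV : Graph → Graph → Set
PV G H = Fin (order G) × Fin (order H)

padj : (G H : Graph) → PV G H → PV G H → Bool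
padj G H (g , h) (g' , h') = adj G g g' ∧ adj H h h'

pOrder : Graph → Graph → ℕ
pOrder G H = order G * order H

sumFin : (n : ℕ) → (Fin n → ℕ) → ℕ
sumFin zero    f = 0
sumFin (suc n) f = f zero + sumFin n (λ i → f (suc i))

sumPV : (G H : Graph) → (PV G H → ℕ) → ℕ
sumPV G H f = sumFin (order G) (λ g → sumFin (order H) (λ h → f (g , h)))

Labeling : Graph → Graph → Set
Labeling G H = PV G H → ℕ

IsBijLabeling : (G H : Graph) → Labeling G H → Set
IsBijLabeling G H ℓ =
  Injective _≡_ _≡_ ℓ
  × (∀ v → 1 ≤ ℓ v × ℓ v ≤ pOrder G H)
  × (∀ i → 1 ≤ i → i ≤ pOrder G H → ∃[ v ] ℓ v ≡ i)

nbrSum : (G H : Graph) → Labeling G H → PV G H → ℕ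
nbrSum G H ℓ x = sumPV G H (λ y → if padj G H x y then ℓ y else 0)

IsDistanceMagicLabeling : (G H : Graph) → Labeling G H → Set
IsDistanceMagicLabeling G H ℓ =
  IsBijLabeling G H ℓ × ∃[ k ] (1 ≤ k × (∀ x → nbrSum G H ℓ x ≡ k))

IsDistanceMagic : (G H : Graph) → Set
IsDistanceMagic G H = ∃[ ℓ ] IsDistanceMagicLabeling G H ℓ

IsBalancedLabeling : (G H : Graph) → Labeling G H → Set
IsBalancedLabeling G H ℓ =
  IsBijLabeling G H ℓ
  × (∀ w u → padj G H w u ≡ true →
       ∃[ v ] (padj G H w v ≡ true × ℓ u + ℓ v ≡ suc (pOrder G H)))

Even : ℕ → Set
Even n = ∃[ m ] n ≡ m + m

IsBalancedDistanceMagic : (G H : Graph) → Set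
IsBalancedDistanceMagic G H =
  IsDistanceMagic G H × Even (pOrder G H) × ∃[ ℓ ] IsBalancedLabeling G H ℓ

Twins : (G H : Graph) → Labeling G H → PV G H → PV G H → Set
Twins G H ℓ u v = ℓ u + ℓ v ≡ suc (pOrder G H)

swapLabels : (G H : Graph) → Labeling G H → PV G H → PV G H → Labeling G H
swapLabels G H ℓ a b x with ≡-dec _≟ᶠ_ _≟ᶠ_ x a
... | yes _ = ℓ b
... | no _ with ≡-dec _≟ᶠ_ _≟ᶠ_ x b
...   | yes _ = ℓ a
...   | no _  = ℓ x

module Submission where

-- The proof has three ingredients.
--  (1) In a balanced labeling twins have the same neighbourhood: the
--      partner that balancedness provides for u inside N(w) must carry
--      the label of v, so by injectivity it is v.
--  (2) A distance magic graph has no isolated vertex (its magic constant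
--      is positive).  If (x₀,y₀) is a neighbour of (g,h), then x₀ is
--      adjacent to both g and g', and comparing the neighbourhoods of u
--      and v along the column x₀ shows N_H(h) = N_H(h').  Hence (g',h')
--      and (g',h) have the same neighbourhood in G × H.
--  (3) Exchanging the labels of two vertices with equal neighbourhoods
--      is relabelling by a transposition that preserves adjacency, and
--      relabelling along any adjacency-preserving involution keeps a
--      labeling balanced.
-- Since (g,h) is neither swapped vertex, the new label of (g',h) is the
-- old label of (g',h') and (g,h) keeps its label, so they are twins.

open import Defs
open import Data.Bool using (true; _∧_; if_then_else_)
open import Data.Bool.Properties using (∧-conicalˡ; ∧-conicalʳ; ⇔→≡)
open import Data.Fin using (Fin; zero; suc)
open import Data.Fin.Properties using () renaming (_≟_ to _≟ᶠ_)
open import Data.Nat using (ℕ; zero; suc; _+_; _≤_; z≤n; s≤s)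
open import Data.Nat.Properties using (+-cancelˡ-≡; +-comm)
open import Data.Product using (_×_; _,_; proj₁; ∃-syntax)
open import Data.Product.Properties using (≡-dec)
open import Function.Bundles using (mk⇔)
open import Relation.Binary.Definitions using (DecidableEquality)
open import Relation.Binary.PropositionalEquality
open import Relation.Nullary using (¬_; yes; no)
open import Data.Empty using (⊥-elim)

sumFin-positive : ∀ n (f : Fin n → ℕ) → 1 ≤ sumFin n f → ∃[ i ] 1 ≤ f i
sumFin-positive (suc n) f p with f zero in f0
... | suc _ = zero , subst (1 ≤_) (sym f0) (s≤s z≤n)
... | zero with sumFin-positive n (λ i → f (suc i)) p
...   | i , q = suc i , q

if-positive : ∀ b (x : ℕ) → 1 ≤ (if b then x else 0) → b ≡ true
if-positive true _ _ = refl

-- A distance magic graph has no isolated vertices: the positive magic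
-- constant is a sum of labels of neighbours, so some neighbour exists.
magic-hasNeighbour : ∀ G H → IsDistanceMagic G H →
  ∀ x → ∃[ y ] padj G H x y ≡ true
magic-hasNeighbour G H (_ , _ , k , 1≤k , magic) x
  with sumFin-positive _ _ (subst (1 ≤_) (sym (magic x)) 1≤k)
... | g , p with sumFin-positive _ _ p
...   | h , q = (g , h) , if-positive _ _ q

-- In a balanced labeling, a vertex adjacent to u is adjacent to every
-- twin v of u: the balancing partner of u in N(w) has v's label.
balanced-twinAdj : ∀ G H ℓ → IsBalancedLabeling G H ℓ →
  ∀ u v → Twins G H ℓ u v → ∀ w → padj G H w u ≡ true → padj G H w v ≡ true
balanced-twinAdj G H ℓ ((inj , _) , bal) u v twins w wu with bal w u wu
... | v' , wv' , partner = subst (λ z → padj G H w z ≡ true) v'≡v wv'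
  where
  v'≡v = inj (+-cancelˡ-≡ (ℓ u) _ _ (trans partner (sym twins)))

balanced-twinsSameNeighbourhood : ∀ G H ℓ → IsBalancedLabeling G H ℓ →
  ∀ u v → Twins G H ℓ u v → ∀ w → padj G H w u ≡ padj G H w v
balanced-twinsSameNeighbourhood G H ℓ bl u v twins w = ⇔→≡ (mk⇔
  (balanced-twinAdj G H ℓ bl u v twins w)
  (balanced-twinAdj G H ℓ bl v u (trans (+-comm (ℓ v) (ℓ u)) twins) w))

product-sameNeighbourhood : ∀ G H (g g' : Fin (order G)) (h h' : Fin (order H)) →
  (∃[ y ] padj G H (g , h) y ≡ true) →
  (∀ w → padj G H w (g , h) ≡ padj G H w (g' , h')) →
  ∀ w → padj G H w (g' , h') ≡ padj G H w (g' , h)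
product-sameNeighbourhood G H g g' h h' ((x₀ , y₀) , adj₀) sameN (x , y) =
  cong (adj G x g' ∧_) (sym (sameColumn y))
  where
  x₀g : adj G x₀ g ≡ true
  x₀g = trans (symm G x₀ g) (∧-conicalˡ _ _ adj₀)
  y₀h : adj H y₀ h ≡ true
  y₀h = trans (symm H y₀ h) (∧-conicalʳ _ _ adj₀)
  x₀g' : adj G x₀ g' ≡ true
  x₀g' = ∧-conicalˡ _ _ (trans (sym (sameN (x₀ , y₀))) (cong₂ _∧_ x₀g y₀h))
  sameColumn : ∀ y → adj H y h ≡ adj H y h'
  sameColumn y = begin
    adj H y h                 ≡⟨ cong (_∧ adj H y h) (sym x₀g) ⟩
    adj G x₀ g ∧ adj H y h    ≡⟨ sameN (x₀ , y) ⟩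
    adj G x₀ g' ∧ adj H y h'  ≡⟨ cong (_∧ adj H y h') x₀g' ⟩
    adj H y h'                ∎
    where open ≡-Reasoning

-- The transposition of a and b on a type with decidable equality, with
-- the same case structure as swapLabels.
module Transposition {A : Set} (_≟_ : DecidableEquality A) (a b : A) where

  transpose : A → A
  transpose x with x ≟ a
  ... | yes _ = b
  ... | no _ with x ≟ b
  ...   | yes _ = a
  ...   | no _  = x

  transpose-a : transpose a ≡ b
  transpose-a with a ≟ a
  ... | yes _ = refl
  ... | no a≢a = ⊥-elim (a≢a refl)

  transpose-b : transpose b ≡ a
  transpose-b with b ≟ a
  ... | yes refl = refl
  ... | no _ with b ≟ b
  ...   | yes _ = refl
  ...   | no b≢b = ⊥-elim (b≢b refl)

  transpose-fix : ∀ {x} → ¬ x ≡ a → ¬ x ≡ b → transpose x ≡ x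
  transpose-fix {x} x≢a x≢b with x ≟ a
  ... | yes x≡a = ⊥-elim (x≢a x≡a)
  ... | no _ with x ≟ b
  ...   | yes x≡b = ⊥-elim (x≢b x≡b)
  ...   | no _ = refl

  data Position (x : A) : Set where
    at-a  : x ≡ a → Position x
    at-b  : x ≡ b → Position x
    fixed : ¬ x ≡ a → ¬ x ≡ b → Position x

  position : ∀ x → Position x
  position x with x ≟ a
  ... | yes x≡a = at-a x≡a
  ... | no x≢a with x ≟ b
  ...   | yes x≡b = at-b x≡b
  ...   | no x≢b = fixed x≢a x≢b

  transpose-involutive : ∀ x → transpose (transpose x) ≡ x
  transpose-involutive x with position x
  ... | at-a refl = trans (cong transpose transpose-a) transpose-b
  ... | at-b refl = trans (cong transpose transpose-b) transpose-a
  ... | fixed x≢a x≢b =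
    trans (cong transpose (transpose-fix x≢a x≢b)) (transpose-fix x≢a x≢b)

  transpose-invariant : ∀ {B : Set} (f : A → B) → f a ≡ f b →
    ∀ x → f (transpose x) ≡ f x
  transpose-invariant f fa≡fb x with position x
  ... | at-a refl = trans (cong f transpose-a) (sym fa≡fb)
  ... | at-b refl = trans (cong f transpose-b) fa≡fb
  ... | fixed x≢a x≢b = cong f (transpose-fix x≢a x≢b)

balanced-relabel : ∀ G H (ℓ ℓ' : Labeling G H) (σ : PV G H → PV G H) →
  (∀ x → σ (σ x) ≡ x) → (∀ w x → padj G H w (σ x) ≡ padj G H w x) →
  (∀ x → ℓ' x ≡ ℓ (σ x)) →
  IsBalancedLabeling G H ℓ → IsBalancedLabeling G H ℓ'
balanced-relabel G H ℓ ℓ' σ σσ σ-adj ℓ'≡ℓσ ((inj , range , onto) , bal) =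
  (inj' , range' , onto') , bal'
  where
  ℓ'σ : ∀ x → ℓ' (σ x) ≡ ℓ x
  ℓ'σ x = trans (ℓ'≡ℓσ (σ x)) (cong ℓ (σσ x))
  inj' : ∀ {x y} → ℓ' x ≡ ℓ' y → x ≡ y
  inj' {x} {y} e = begin
    x         ≡⟨ sym (σσ x) ⟩
    σ (σ x)   ≡⟨ cong σ (inj (trans (sym (ℓ'≡ℓσ x)) (trans e (ℓ'≡ℓσ y)))) ⟩
    σ (σ y)   ≡⟨ σσ y ⟩
    y         ∎
    where open ≡-Reasoning
  range' : ∀ v → 1 ≤ ℓ' v × ℓ' v ≤ pOrder G H
  range' v = subst (λ n → 1 ≤ n × n ≤ pOrder G H) (sym (ℓ'≡ℓσ v)) (range (σ v))
  onto' : ∀ i → 1 ≤ i → i ≤ pOrder G H → ∃[ v ] ℓ' v ≡ i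
  onto' i 1≤i i≤n with onto i 1≤i i≤n
  ... | v , ℓv≡i = σ v , trans (ℓ'σ v) ℓv≡i
  bal' : ∀ w u → padj G H w u ≡ true →
    ∃[ v ] (padj G H w v ≡ true × ℓ' u + ℓ' v ≡ suc (pOrder G H))
  bal' w u wu with bal w (σ u) (trans (σ-adj w u) wu)
  ... | v , wv , partner = σ v , trans (σ-adj w v) wv ,
    trans (cong₂ _+_ (ℓ'≡ℓσ u) (ℓ'σ v)) partner

-- Equality of vertices of G × H is decided componentwise; this is the
-- decision procedure swapLabels branches on.
vertex-≟ : ∀ G H → DecidableEquality (PV G H)
vertex-≟ G H = ≡-dec _≟ᶠ_ _≟ᶠ_

swapLabels-transpose : ∀ G H (ℓ : Labeling G H) a b x →
  swapLabels G H ℓ a b x ≡ ℓ (Transposition.transpose (vertex-≟ G H) a b x)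
swapLabels-transpose G H ℓ a b x with vertex-≟ G H x a
... | yes _ = refl
... | no _ with vertex-≟ G H x b
...   | yes _ = refl
...   | no _ = refl

swapLabels-balanced : ∀ G H (ℓ : Labeling G H) a b →
  (∀ w → padj G H w a ≡ padj G H w b) →
  IsBalancedLabeling G H ℓ → IsBalancedLabeling G H (swapLabels G H ℓ a b)
swapLabels-balanced G H ℓ a b sameN =
  balanced-relabel G H ℓ _ transpose transpose-involutive
    (λ w → transpose-invariant (padj G H w) (sameN w))
    (swapLabels-transpose G H ℓ a b)
  where open Transposition (vertex-≟ G H) a b

lemma2p2 : (G H : Graph) → IsBalancedDistanceMagic G H →
    (ℓ : Labeling G H) → IsBalancedLabeling G H ℓ →
    (g g' : Fin (order G)) (h h' : Fin (order H)) →
    ¬ g ≡ g' → ¬ h ≡ h' →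
    Twins G H ℓ (g , h) (g' , h') →
    IsBalancedLabeling G H (swapLabels G H ℓ (g' , h') (g' , h))
    × Twins G H (swapLabels G H ℓ (g' , h') (g' , h)) (g , h) (g' , h)
lemma2p2 G H (magic , _) ℓ bl g g' h h' g≢g' _ twins =
  swapLabels-balanced G H ℓ a b sameN bl , newTwins
  where
  a b : PV G H
  a = (g' , h')
  b = (g' , h)
  open Transposition (vertex-≟ G H) a b
  sameN : ∀ w → padj G H w a ≡ padj G H w b
  sameN = product-sameNeighbourhood G H g g' h h'
    (magic-hasNeighbour G H magic (g , h))
    (balanced-twinsSameNeighbourhood G H ℓ bl (g , h) a twins)
  notSwapped : ∀ {y} → ¬ (g , h) ≡ (g' , y)
  notSwapped e = g≢g' (cong proj₁ e)
  newTwins : Twins G H (swapLabels G H ℓ a b) (g , h) b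
  newTwins = begin
    swapLabels G H ℓ a b (g , h) + swapLabels G H ℓ a b b
      ≡⟨ cong₂ _+_ (swapLabels-transpose G H ℓ a b (g , h))
                   (swapLabels-transpose G H ℓ a b b) ⟩
    ℓ (transpose (g , h)) + ℓ (transpose b)
      ≡⟨ cong₂ _+_ (cong ℓ (transpose-fix notSwapped notSwapped))
                   (cong ℓ transpose-b) ⟩
    ℓ (g , h) + ℓ a
      ≡⟨ twins ⟩
    suc (pOrder G H) ∎
    where open ≡-Reasoning
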